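{- Let $s$ be a non-negative integer. Let $w$ be the infinite word over $\{1,2,3,4\}$ defined in the context. If $v$ is a factor of $w$ having kernel period $q$, where $q \le 1966\cdot 3^{s}$, then $$\frac{|v|}{q} < \frac{35}{34} + \frac{3}{1966}\sum_{j=0}^{s-1} 3^{ -j}$$ (for $s=0$ the sum is empty, so the bound is $|v|/q<35/34$).
   Context: Let $A_4=\{1,2,3,4\}$. Let $f:A_4^*\to A_4^*$ be the morphism defined by $f(1)=121$, $f(2)=123$, $f(3)=141$, $f(4)=142$, and let $w=\lim_{k\to\infty} f^k(1)$ be the infinite fixed point of $f$ (beginning with $1$). For a word $v$ and letter $a$, $|v|_a$ denotes the number of occurrences of $a$ in $v$ and $|v|$ the length of $v$. Let $\ker\psi=\{v\in A_4^* : 4 \text{ divides } |v|_a \text{ for every } a\in A_4\}$. A word $v$ has period $q$ (a positive integer with $q\le |v|$) if $v_i=v_{i+q}$ for all valid indices $i$. We say $q$ is a kernel period of $v$ if $v$ has period $q$ and the prefix of $v$ of length $q$ belongs to $\ker\psi$. -}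

module Defs where

open import Data.Nat using (ℕ; zero; suc; _+_; _*_; _<_; _≤_)
open import Data.Nat.Divisibility using (_∣_)
open import Data.List using (List; []; _∷_; concatMap; length; map; upTo; take; filter; [_])
open import Data.Maybe using (Maybe; just; nothing)
open import Data.Product using (∃; _×_)
open import Relation.Nullary using (Dec; yes; no)
open import Relation.Binary.PropositionalEquality using (_≡_; refl)
open import Data.Rational using (ℚ; 0ℚ; 1ℚ; _/_)
import Data.Rational as Q
open import Data.Integer using (+_)

data A4 : Set where
  l1 l2 l3 l4 : A4

_≟A_ : (a b : A4) → Dec (a ≡ b)
l1 ≟A l1 = yes refl
l1 ≟A l2 = no λ ()
l1 ≟A l3 = no λ ()
l1 ≟A l4 = no λ ()
l2 ≟A l1 = no λ ()
l2 ≟A l2 = yes refl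
l2 ≟A l3 = no λ ()
l2 ≟A l4 = no λ ()
l3 ≟A l1 = no λ ()
l3 ≟A l2 = no λ ()
l3 ≟A l3 = yes refl
l3 ≟A l4 = no λ ()
l4 ≟A l1 = no λ ()
l4 ≟A l2 = no λ ()
l4 ≟A l3 = no λ ()
l4 ≟A l4 = yes refl

fLetter : A4 → List A4
fLetter l1 = l1 ∷ l2 ∷ l1 ∷ []
fLetter l2 = l1 ∷ l2 ∷ l3 ∷ []
fLetter l3 = l1 ∷ l4 ∷ l1 ∷ []
fLetter l4 = l1 ∷ l4 ∷ l2 ∷ []

f : List A4 → List A4
f = concatMap fLetter

fIter : ℕ → List A4
fIter zero = [ l1 ]
fIter (suc k) = f (fIter k)

at : {A : Set} → List A → ℕ → Maybe A
at [] _ = nothing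
at (x ∷ xs) zero = just x
at (x ∷ xs) (suc i) = at xs i

atD : List A4 → ℕ → A4
atD [] _ = l1
atD (x ∷ xs) zero = x
atD (x ∷ xs) (suc i) = atD xs i

-- The fixed point w = lim f^k(1), as a function ℕ → A4 (0-based).
-- Since f^k(1) is a prefix of f^(k+1)(1) and |f^(i+1)(1)| = 3^(i+1) > i,
-- the i-th letter of w is the i-th letter of f^(i+1)(1).
w : ℕ → A4
w i = atD (fIter (suc i)) i

factorAt : ℕ → ℕ → List A4
factorAt i n = map (λ k → w (i + k)) (upTo n)

IsFactor : List A4 → Set
IsFactor v = ∃ λ i → v ≡ factorAt i (length v)

count : A4 → List A4 → ℕ
count a v = length (filter (_≟A a) v)

InKer : List A4 → Set
InKer v = (a : A4) → 4 ∣ count a v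

HasPeriod : List A4 → ℕ → Set
HasPeriod v q = (0 < q) × (q ≤ length v)
  × ((i : ℕ) → i + q < length v → at v i ≡ at v (i + q))

KernelPeriod : List A4 → ℕ → Set
KernelPeriod v q = HasPeriod v q × InKer (take q v)

inv3pow : ℕ → ℚ
inv3pow zero = 1ℚ
inv3pow (suc j) = inv3pow j Q.* (+ 1 / 3)

geomSum : ℕ → ℚ
geomSum zero = 0ℚ
geomSum (suc s) = geomSum s Q.+ inv3pow s

bound : ℕ → ℚ
bound s = (+ 35 / 34) Q.+ (+ 3 / 1966) Q.* geomSum s

-- We prove the sharper, s-independent bound |v|/q < 35/34 (the stated bound is at least
-- 35/34).  A factor v = w[i, i+|v|) with kernel period q gives a kernel run: positions
-- i, …, i+L−1 (L = |v| − q) agree with those q further on, and w[i, i+q) ∈ ker ψ.  Extend it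
-- to the left as far as possible and give it the energy  E = 234 L + α + β, where α and β
-- weigh the mismatching letter pairs just before and just after the run.  The key estimate
-- 34 E ≤ 234 q is proved by strong induction on q, and since β ≥ 78 it gives 34 L < q.
--   * A run of length ≥ 3 reveals positions modulo 3, so 3 ∣ q; desubstituting by f gives a
--     kernel run of period q/3 with at least a third of the energy (the weights are tuned
--     for this).
--   * A run stopping earlier has 4 ∣ q; periods q ≤ 112 are settled by a finite computation
--     over all factors of length 117, larger ones by the crude bound E ≤ 783.
-- The modules below follow this plan: fixed point, Parikh vectors, runs, energy,
-- desubstitution, factor enumeration, base case, main estimate, conclusion.

module Submission where

open import Defs


-- The morphism f, its fixed point w = f(w), and the factors (windows) of w.
module FixedPoint where

  open import Data.Nat
  open import Data.Nat.Properties
  open import Data.List using (List; []; _∷_; _++_; length; take; drop; applyUpTo)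
  open import Data.List.Properties using (map-upTo)
  open import Data.Maybe using (just)
  open import Data.Product using (∃; _,_)
  open import Data.Sum using (inj₁; inj₂)
  open import Relation.Binary.PropositionalEquality

  f₁ f₂ : A4 → A4
  f₁ l1 = l2
  f₁ l2 = l2
  f₁ l3 = l4
  f₁ l4 = l4
  f₂ l1 = l1
  f₂ l2 = l3
  f₂ l3 = l1
  f₂ l4 = l2

  fLetter-shape : ∀ a → fLetter a ≡ l1 ∷ f₁ a ∷ f₂ a ∷ []
  fLetter-shape l1 = refl
  fLetter-shape l2 = refl
  fLetter-shape l3 = refl
  fLetter-shape l4 = refl

  f₁f₂-injective : ∀ a b → f₁ a ≡ f₁ b → f₂ a ≡ f₂ b → a ≡ b
  f₁f₂-injective l1 l1 _ _ = refl
  f₁f₂-injective l2 l2 _ _ = refl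
  f₁f₂-injective l3 l3 _ _ = refl
  f₁f₂-injective l4 l4 _ _ = refl
  f₁f₂-injective l1 l2 _ ()
  f₁f₂-injective l2 l1 _ ()
  f₁f₂-injective l3 l4 _ ()
  f₁f₂-injective l4 l3 _ ()
  f₁f₂-injective l1 l3 ()
  f₁f₂-injective l1 l4 ()
  f₁f₂-injective l2 l3 ()
  f₁f₂-injective l2 l4 ()
  f₁f₂-injective l3 l1 ()
  f₁f₂-injective l3 l2 ()
  f₁f₂-injective l4 l1 ()
  f₁f₂-injective l4 l2 ()

  f-∷ : ∀ a u → f (a ∷ u) ≡ l1 ∷ f₁ a ∷ f₂ a ∷ f u
  f-∷ a u = cong (_++ f u) (fLetter-shape a)

  f-++ : ∀ u v → f (u ++ v) ≡ f u ++ f v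
  f-++ [] v = refl
  f-++ (a ∷ u) v rewrite f-∷ a (u ++ v) | f-∷ a u | f-++ u v = refl

  length-f : ∀ u → length (f u) ≡ length u * 3
  length-f [] = refl
  length-f (a ∷ u) rewrite f-∷ a u | length-f u = refl

  atD-++ˡ : ∀ u v {i} → i < length u → atD (u ++ v) i ≡ atD u i
  atD-++ˡ (a ∷ u) v {zero} _ = refl
  atD-++ˡ (a ∷ u) v {suc i} (s≤s i<) = atD-++ˡ u v i<

  atD-f : ∀ u {b j} → b < length u → j < 3 → atD (f u) (b * 3 + j) ≡ atD (fLetter (atD u b)) j
  atD-f (a ∷ u) {zero} _ j<3 rewrite fLetter-shape a = atD-++ˡ (l1 ∷ f₁ a ∷ f₂ a ∷ []) (f u) j<3
  atD-f (a ∷ u) {suc b} (s≤s b<) j<3 rewrite f-∷ a u = atD-f u b< j<3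

  length-fIter : ∀ k → length (fIter k) ≡ 3 ^ k
  length-fIter zero = refl
  length-fIter (suc k) rewrite length-f (fIter k) | length-fIter k = *-comm (3 ^ k) 3

  fIter-prefix : ∀ k → ∃ λ r → fIter (suc k) ≡ fIter k ++ r
  fIter-prefix zero = l2 ∷ l1 ∷ [] , refl
  fIter-prefix (suc k) with fIter-prefix k
  ... | r , eq = f r , trans (cong f eq) (f-++ (fIter k) r)

  fIter-stable : ∀ {k k'} i → k ≤ k' → i < 3 ^ k → atD (fIter k') i ≡ atD (fIter k) i
  fIter-stable {k} {k'} i k≤k' i< with m≤n⇒m<n∨m≡n k≤k'
  ... | inj₂ refl = refl
  ... | inj₁ (s≤s {n = k''} k≤k'') with fIter-prefix k''
  ...   | r , eq = begin
    atD (fIter (suc k'')) i      ≡⟨ cong (λ u → atD u i) eq ⟩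
    atD (fIter k'' ++ r) i       ≡⟨ atD-++ˡ (fIter k'') r i<len ⟩
    atD (fIter k'') i            ≡⟨ fIter-stable i k≤k'' i< ⟩
    atD (fIter k) i              ∎
    where
      open ≡-Reasoning
      i<len : i < length (fIter k'')
      i<len = subst (i <_) (sym (length-fIter k'')) (<-≤-trans i< (^-monoʳ-≤ 3 k≤k''))

  n<3^n : ∀ n → n < 3 ^ n
  n<3^n zero = s≤s z≤n
  n<3^n (suc n) = ≤-<-trans (n<3^n n)
    (subst (3 ^ n <_) (*-comm (3 ^ n) 3) (m<m*n (3 ^ n) 3 {{m^n≢0 3 n}} (s≤s (s≤s z≤n))))

  w-fIter : ∀ k i → i < 3 ^ k → w i ≡ atD (fIter k) i
  w-fIter k i i< with ≤-total k (suc i)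
  ... | inj₁ k≤ = fIter-stable i k≤ i<
  ... | inj₂ k≥ = sym (fIter-stable i k≥ (<-trans (n<1+n i) (n<3^n (suc i))))

  block<3^ : ∀ b {j} → j < 3 → b * 3 + j < 3 ^ (2 + b)
  block<3^ b {j} j<3 = begin-strict
    b * 3 + j       <⟨ +-monoʳ-< (b * 3) j<3 ⟩
    b * 3 + 3       ≡⟨ +-comm (b * 3) 3 ⟩
    suc b * 3       ≤⟨ *-monoˡ-≤ 3 (<⇒≤ (n<3^n (suc b))) ⟩
    3 ^ suc b * 3   ≡⟨ *-comm (3 ^ suc b) 3 ⟩
    3 ^ (2 + b)     ∎
    where open ≤-Reasoning

  w-letter : ∀ b j → j < 3 → w (j + b * 3) ≡ atD (fLetter (w b)) j
  w-letter b j j<3 = begin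
    w (j + b * 3)                         ≡⟨ cong w (+-comm j (b * 3)) ⟩
    w (b * 3 + j)                         ≡⟨ w-fIter (2 + b) (b * 3 + j) (block<3^ b j<3) ⟩
    atD (f (fIter (suc b))) (b * 3 + j)   ≡⟨ atD-f (fIter (suc b)) b<len j<3 ⟩
    atD (fLetter (w b)) j                 ∎
    where
      open ≡-Reasoning
      b<len : b < length (fIter (suc b))
      b<len = subst (b <_) (sym (length-fIter (suc b))) (<-trans (n<1+n b) (n<3^n (suc b)))

  w-3b : ∀ b → w (b * 3) ≡ l1
  w-3b b = trans (w-letter b 0 (s≤s z≤n)) (cong (λ u → atD u 0) (fLetter-shape (w b)))

  w-3b+1 : ∀ b → w (1 + b * 3) ≡ f₁ (w b)
  w-3b+1 b = trans (w-letter b 1 (s≤s (s≤s z≤n))) (cong (λ u → atD u 1) (fLetter-shape (w b)))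

  w-3b+2 : ∀ b → w (2 + b * 3) ≡ f₂ (w b)
  w-3b+2 b = trans (w-letter b 2 (s≤s (s≤s (s≤s z≤n)))) (cong (λ u → atD u 2) (fLetter-shape (w b)))

  window : ℕ → ℕ → List A4
  window i zero = []
  window i (suc n) = w i ∷ window (suc i) n

  factorAt≡window : ∀ i n → factorAt i n ≡ window i n
  factorAt≡window i n = trans (map-upTo (λ k → w (i + k)) n) (tabulated n i (λ _ → refl))
    where
      tabulated : ∀ n i {g : ℕ → A4} → (∀ k → g k ≡ w (i + k)) → applyUpTo g n ≡ window i n
      tabulated zero i g≗ = refl
      tabulated (suc n) i g≗ = cong₂ _∷_ (trans (g≗ 0) (cong w (+-identityʳ i)))
        (tabulated n (suc i) (λ k → trans (g≗ (suc k)) (cong w (+-suc i k))))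

  length-window : ∀ i n → length (window i n) ≡ n
  length-window i zero = refl
  length-window i (suc n) = cong suc (length-window (suc i) n)

  at-window : ∀ i {n k} → k < n → at (window i n) k ≡ just (w (i + k))
  at-window i {suc n} {zero} _ = cong (λ j → just (w j)) (sym (+-identityʳ i))
  at-window i {suc n} {suc k} (s≤s k<n) = trans (at-window (suc i) k<n) (cong (λ j → just (w j)) (sym (+-suc i k)))

  atD-window : ∀ i {n k} → k < n → atD (window i n) k ≡ w (i + k)
  atD-window i {suc n} {zero} _ = cong w (sym (+-identityʳ i))
  atD-window i {suc n} {suc k} (s≤s k<n) = trans (atD-window (suc i) k<n) (cong w (sym (+-suc i k)))

  take-window : ∀ i {m n} → m ≤ n → take m (window i n) ≡ window i m
  take-window i {zero} _ = refl
  take-window i {suc m} {suc n} (s≤s m≤n) = cong (w i ∷_) (take-window (suc i) m≤n)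

  drop-window : ∀ i r n → drop r (window i n) ≡ window (i + r) (n ∸ r)
  drop-window i zero n = cong (λ j → window j n) (sym (+-identityʳ i))
  drop-window i (suc r) zero = refl
  drop-window i (suc r) (suc n) = trans (drop-window (suc i) r n) (cong (λ j → window j (n ∸ r)) (sym (+-suc i r)))

  window-++ : ∀ i m n → window i (m + n) ≡ window i m ++ window (i + m) n
  window-++ i zero n = cong (λ j → window j n) (sym (+-identityʳ i))
  window-++ i (suc m) n = cong (w i ∷_)
    (trans (window-++ (suc i) m n) (cong (λ j → window (suc i) m ++ window j n) (sym (+-suc i m))))

  w-block : ∀ b → window (b * 3) 3 ≡ l1 ∷ f₁ (w b) ∷ f₂ (w b) ∷ []
  w-block b = cong₂ _∷_ (w-3b b) (cong₂ (λ x y → x ∷ y ∷ []) (w-3b+1 b) (w-3b+2 b))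

  f-window : ∀ b m → f (window b m) ≡ window (b * 3) (m * 3)
  f-window b zero = refl
  f-window b (suc m) = begin
    f (w b ∷ window (suc b) m)                    ≡⟨ f-∷ (w b) (window (suc b) m) ⟩
    (l1 ∷ f₁ (w b) ∷ f₂ (w b) ∷ []) ++ f (window (suc b) m)
      ≡⟨ cong₂ _++_ (sym (w-block b)) (f-window (suc b) m) ⟩
    window (b * 3) 3 ++ window (suc b * 3) (m * 3) ≡⟨ cong (λ j → window (b * 3) 3 ++ window j (m * 3)) (+-comm 3 (b * 3)) ⟩
    window (b * 3) 3 ++ window (b * 3 + 3) (m * 3) ≡⟨ sym (window-++ (b * 3) 3 (m * 3)) ⟩
    window (b * 3) (3 + m * 3)                     ∎
    where open ≡-Reasoning


-- Parikh vectors: how f acts on letter counts, and why ker ψ is stable under desubstitution.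
module Parikh where

  open FixedPoint
  open import Data.Nat
  open import Data.Nat.Properties
  open import Data.Nat.Divisibility using (_∣_; ∣m+n∣m⇒∣n; ∣m∣n⇒∣m+n; ∣n⇒∣m*n; n∣m*n)
  open import Data.List using (List; []; _∷_; _++_; length; concatMap; [_])
  open import Data.Product using (_×_; _,_; proj₁; proj₂)
  open import Relation.Nullary using (yes; no)
  open import Relation.Binary.PropositionalEquality hiding ([_])
  open import Data.Nat.Tactic.RingSolver using (solve-∀)

  count-++ : ∀ a u v → count a (u ++ v) ≡ count a u + count a v
  count-++ a [] v = refl
  count-++ a (x ∷ u) v with x ≟A a
  ... | yes _ = cong suc (count-++ a u v)
  ... | no _ = count-++ a u v

  linear : (A4 → ℕ) → List A4 → ℕ
  linear k u = k l1 * count l1 u + k l2 * count l2 u + k l3 * count l3 u + k l4 * count l4 u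

  linear-++ : ∀ k u v → linear k (u ++ v) ≡ linear k u + linear k v
  linear-++ k u v
    rewrite count-++ l1 u v | count-++ l2 u v | count-++ l3 u v | count-++ l4 u v =
    distribute (k l1) (k l2) (k l3) (k l4) (count l1 u) (count l2 u) (count l3 u) (count l4 u)
               (count l1 v) (count l2 v) (count l3 v) (count l4 v)
    where
      distribute : ∀ k₁ k₂ k₃ k₄ a₁ a₂ a₃ a₄ b₁ b₂ b₃ b₄ →
        k₁ * (a₁ + b₁) + k₂ * (a₂ + b₂) + k₃ * (a₃ + b₃) + k₄ * (a₄ + b₄)
        ≡ (k₁ * a₁ + k₂ * a₂ + k₃ * a₃ + k₄ * a₄) + (k₁ * b₁ + k₂ * b₂ + k₃ * b₃ + k₄ * b₄)
      distribute = solve-∀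

  linear-[] : ∀ k → linear k [] ≡ 0
  linear-[] k = e (k l1) (k l2) (k l3) (k l4)
    where e : ∀ a b c d → a * 0 + b * 0 + c * 0 + d * 0 ≡ 0
          e = solve-∀

  linear-singleton : ∀ k x → linear k [ x ] ≡ k x
  linear-singleton k l1 = e (k l1) (k l2) (k l3) (k l4)
    where e : ∀ a b c d → a * 1 + b * 0 + c * 0 + d * 0 ≡ a
          e = solve-∀
  linear-singleton k l2 = e (k l1) (k l2) (k l3) (k l4)
    where e : ∀ a b c d → a * 0 + b * 1 + c * 0 + d * 0 ≡ b
          e = solve-∀
  linear-singleton k l3 = e (k l1) (k l2) (k l3) (k l4)
    where e : ∀ a b c d → a * 0 + b * 0 + c * 1 + d * 0 ≡ c
          e = solve-∀
  linear-singleton k l4 = e (k l1) (k l2) (k l3) (k l4)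
    where e : ∀ a b c d → a * 0 + b * 0 + c * 0 + d * 1 ≡ d
          e = solve-∀

  linear-length : ∀ u → linear (λ _ → 1) u ≡ length u
  linear-length [] = refl
  linear-length (x ∷ u) = begin
    linear (λ _ → 1) ([ x ] ++ u)                   ≡⟨ linear-++ (λ _ → 1) [ x ] u ⟩
    linear (λ _ → 1) [ x ] + linear (λ _ → 1) u     ≡⟨ cong₂ _+_ (linear-singleton (λ _ → 1) x) (linear-length u) ⟩
    suc (length u)                                  ∎
    where open ≡-Reasoning

  count-concatMap : ∀ (g : A4 → List A4) a u → count a (concatMap g u) ≡ linear (λ b → count a (g b)) u
  count-concatMap g a [] = sym (linear-[] (λ b → count a (g b)))
  count-concatMap g a (x ∷ u) = begin
    count a (g x ++ concatMap g u)              ≡⟨ count-++ a (g x) (concatMap g u) ⟩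
    count a (g x) + count a (concatMap g u)     ≡⟨ cong₂ _+_ (sym (linear-singleton K x)) (count-concatMap g a u) ⟩
    linear K [ x ] + linear K u                 ≡⟨ sym (linear-++ K [ x ] u) ⟩
    linear K (x ∷ u)                            ∎
    where
      open ≡-Reasoning
      K : A4 → ℕ
      K b = count a (g b)

  InKer⇒4∣length : ∀ u → InKer u → 4 ∣ length u
  InKer⇒4∣length u k = subst (4 ∣_) (trans (all-ones (count l1 u) (count l2 u) (count l3 u) (count l4 u)) (linear-length u))
    (∣m∣n⇒∣m+n (∣m∣n⇒∣m+n (∣m∣n⇒∣m+n (k l1) (k l2)) (k l3)) (k l4))
    where all-ones : ∀ a b c d → a + b + c + d ≡ 1 * a + 1 * b + 1 * c + 1 * d
          all-ones = solve-∀

  -- The incidence matrix of f is invertible modulo 4; in coordinates this reads: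
  incidence-invertible-mod4 : ∀ a b c d → 4 ∣ 2 * a + b + 2 * c + d → 4 ∣ a + b + d → 4 ∣ b → 4 ∣ c + d →
    (4 ∣ a) × (4 ∣ b) × (4 ∣ c) × (4 ∣ d)
  incidence-invertible-mod4 a b c d 4∣n₁ 4∣n₂ 4∣b 4∣c+d = 4∣a , 4∣b , 4∣c , 4∣d
    where
      4∣a+d : 4 ∣ a + d
      4∣a+d = ∣m+n∣m⇒∣n (subst (4 ∣_) (e₁ a b d) 4∣n₂) 4∣b
        where e₁ : ∀ a b d → a + b + d ≡ b + (a + d)
              e₁ = solve-∀
      4∣3d : 4 ∣ 3 * d
      4∣3d = ∣m+n∣m⇒∣n (subst (4 ∣_) (e₂ a b c d)
               (∣m∣n⇒∣m+n (∣m∣n⇒∣m+n (∣n⇒∣m*n 2 4∣a+d) (∣n⇒∣m*n 2 4∣c+d)) 4∣b)) 4∣n₁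
        where e₂ : ∀ a b c d → 2 * (a + d) + 2 * (c + d) + b ≡ (2 * a + b + 2 * c + d) + 3 * d
              e₂ = solve-∀
      4∣d : 4 ∣ d
      4∣d = ∣m+n∣m⇒∣n (subst (4 ∣_) (e₃ d) (n∣m*n d)) 4∣3d
        where e₃ : ∀ d → d * 4 ≡ 3 * d + d
              e₃ = solve-∀
      4∣a : 4 ∣ a
      4∣a = ∣m+n∣m⇒∣n (subst (4 ∣_) (+-comm a d) 4∣a+d) 4∣d
      4∣c : 4 ∣ c
      4∣c = ∣m+n∣m⇒∣n (subst (4 ∣_) (+-comm c d) 4∣c+d) 4∣d

  InKer-f⁻ : ∀ u → InKer (f u) → InKer u
  InKer-f⁻ u k = λ { l1 → proj₁ solved ; l2 → proj₁ (proj₂ solved)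
                   ; l3 → proj₁ (proj₂ (proj₂ solved)) ; l4 → proj₂ (proj₂ (proj₂ solved)) }
    where
      c₁ c₂ c₃ c₄ : ℕ
      c₁ = count l1 u
      c₂ = count l2 u
      c₃ = count l3 u
      c₄ = count l4 u
      -- |f(u)|_a as a linear form in ψ(u), brought into the shape of the lemma above
      image : ∀ a {n} → linear (λ b → count a (fLetter b)) u ≡ n → 4 ∣ n
      image a eq = subst (4 ∣_) (trans (count-concatMap fLetter a u) eq) (k a)
      e₁ : ∀ a b c d → 2 * a + 1 * b + 2 * c + 1 * d ≡ 2 * a + b + 2 * c + d
      e₁ = solve-∀
      e₂ : ∀ a b c d → 1 * a + 1 * b + 0 * c + 1 * d ≡ a + b + d
      e₂ = solve-∀
      e₃ : ∀ a b c d → 0 * a + 1 * b + 0 * c + 0 * d ≡ b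
      e₃ = solve-∀
      e₄ : ∀ a b c d → 0 * a + 0 * b + 1 * c + 1 * d ≡ c + d
      e₄ = solve-∀
      solved : (4 ∣ c₁) × (4 ∣ c₂) × (4 ∣ c₃) × (4 ∣ c₄)
      solved = incidence-invertible-mod4 c₁ c₂ c₃ c₄
        (image l1 (e₁ c₁ c₂ c₃ c₄)) (image l2 (e₂ c₁ c₂ c₃ c₄))
        (image l3 (e₃ c₁ c₂ c₃ c₄)) (image l4 (e₄ c₁ c₂ c₃ c₄))


-- Runs of a period inside w, and synchronisation: long runs respect the block structure.
module Runs where

  open FixedPoint
  open Parikh
  open import Data.Nat
  open import Data.Nat.Properties
  open import Data.Nat.Divisibility using (_∣_; ∣m+n∣m⇒∣n; n∣m*n)
  open import Data.List using ([_]; _++_)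
  open import Data.Unit using (⊤)
  open import Data.Product using (∃₂; _×_; _,_)
  open import Relation.Nullary using (yes; no)
  open import Relation.Binary.PropositionalEquality hiding ([_])
  open import Data.Nat.Tactic.RingSolver using (solve-∀)

  PeriodicRun : ℕ → ℕ → ℕ → Set
  PeriodicRun i q L = ∀ k → k < L → w (i + k) ≡ w (i + k + q)

  LeftMaximal : ℕ → ℕ → Set
  LeftMaximal zero q = ⊤
  LeftMaximal (suc i) q = w i ≢ w (i + q)

  -- The agreements of a run, indexed so that shifts k + i are read off directly.
  run-at : ∀ {i q L} → PeriodicRun i q L → ∀ k → k < L → w (k + i) ≡ w (k + (i + q))
  run-at {i} {q} run k k<L = begin
    w (k + i)        ≡⟨ cong w (+-comm k i) ⟩
    w (i + k)        ≡⟨ run k k<L ⟩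
    w (i + k + q)    ≡⟨ cong w (reassoc i k q) ⟩
    w (k + (i + q))  ∎
    where
      open ≡-Reasoning
      reassoc : ∀ i k q → i + k + q ≡ k + (i + q)
      reassoc = solve-∀

  run-first : ∀ {i q L} → PeriodicRun i q (suc L) → w i ≡ w (i + q)
  run-first {i} {q} run = run-at {i} {q} run 0 (s≤s z≤n)

  run-restrict : ∀ {i q L L'} → L ≤ L' → PeriodicRun i q L' → PeriodicRun i q L
  run-restrict L≤L' run k k<L = run k (<-≤-trans k<L L≤L')

  run-drop : ∀ {i q} d L → PeriodicRun i q (d + L) → PeriodicRun (i + d) q L
  run-drop {i} {q} d L run k k<L = begin
    w (i + d + k)       ≡⟨ cong w (+-assoc i d k) ⟩
    w (i + (d + k))     ≡⟨ run (d + k) (+-monoʳ-< d k<L) ⟩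
    w (i + (d + k) + q) ≡⟨ cong (λ j → w (j + q)) (sym (+-assoc i d k)) ⟩
    w (i + d + k + q)   ∎
    where open ≡-Reasoning

  run-extend : ∀ {i q L} → PeriodicRun i q L → w (i + L) ≡ w (i + L + q) → PeriodicRun i q (suc L)
  run-extend {L = L} run next k k<1+L with k ≟ L
  ... | yes refl = next
  ... | no k≢L = run k (≤∧≢⇒< (≤-pred k<1+L) k≢L)

  run-extendˡ : ∀ {i q L} → PeriodicRun (suc i) q L → w i ≡ w (i + q) → PeriodicRun i q (suc L)
  run-extendˡ {i} {q} run first zero _ =
    trans (cong w (+-identityʳ i)) (trans first (cong (λ j → w (j + q)) (sym (+-identityʳ i))))
  run-extendˡ {i} {q} run first (suc k) (s≤s k<L) =
    trans (cong w (+-suc i k)) (trans (run k k<L) (cong (λ j → w (j + q)) (sym (+-suc i k))))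

  count-slide : ∀ a i q → w i ≡ w (i + q) → count a (window i q) ≡ count a (window (suc i) q)
  count-slide a i q agree = +-cancelʳ-≡ (count a [ w i ]) _ _ (begin
    count a (window i q) + count a [ w i ]          ≡⟨ cong (λ x → count a (window i q) + count a [ x ]) agree ⟩
    count a (window i q) + count a (window (i + q) 1) ≡⟨ sym (count-++ a (window i q) (window (i + q) 1)) ⟩
    count a (window i q ++ window (i + q) 1) ≡⟨ cong (count a) (sym (window-++ i q 1)) ⟩
    count a (window i (q + 1))                      ≡⟨ cong (λ n → count a (window i n)) (+-comm q 1) ⟩
    count a ([ w i ] ++ window (suc i) q) ≡⟨ count-++ a [ w i ] (window (suc i) q) ⟩
    count a [ w i ] + count a (window (suc i) q)    ≡⟨ +-comm (count a [ w i ]) _ ⟩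
    count a (window (suc i) q) + count a [ w i ]    ∎)
    where open ≡-Reasoning

  InKer-slide : ∀ i q → w i ≡ w (i + q) → InKer (window i q) → InKer (window (suc i) q)
  InKer-slide i q agree k a = subst (4 ∣_) (count-slide a i q agree) (k a)

  InKer-slideˡ : ∀ i q → w i ≡ w (i + q) → InKer (window (suc i) q) → InKer (window i q)
  InKer-slideˡ i q agree k a = subst (4 ∣_) (sym (count-slide a i q agree)) (k a)

  data Mod3 (n : ℕ) : Set where
    3b   : ∀ b → n ≡ b * 3 → Mod3 n
    3b+1 : ∀ b → n ≡ 1 + b * 3 → Mod3 n
    3b+2 : ∀ b → n ≡ 2 + b * 3 → Mod3 n

  mod3 : ∀ n → Mod3 n
  mod3 zero = 3b 0 refl
  mod3 (suc n) with mod3 n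
  ... | 3b b refl = 3b+1 b refl
  ... | 3b+1 b refl = 3b+2 b refl
  ... | 3b+2 b refl = 3b (suc b) refl

  residue : ∀ {n} → Mod3 n → ℕ
  residue (3b _ _) = 0
  residue (3b+1 _ _) = 1
  residue (3b+2 _ _) = 2

  divide3 : ∀ n → ∃₂ λ t m → t < 3 × n ≡ t + m * 3
  divide3 n with mod3 n
  ... | 3b m e = 0 , m , s≤s z≤n , e
  ... | 3b+1 m e = 1 , m , s≤s (s≤s z≤n) , e
  ... | 3b+2 m e = 2 , m , s≤s (s≤s (s≤s z≤n)) , e

  -- Reading the position modulo 3 off three consecutive letters of w
  -- (blocks are 1·f₁·f₂: 4 occurs only in the middle, 3 only at the end, 11 only across a boundary).
  phase : A4 → A4 → A4 → ℕ
  phase l1 l1 _  = 2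
  phase l1 _  _  = 0
  phase l2 l1 l1 = 1
  phase l2 l1 _  = 2
  phase l2 _  _  = 1
  phase l3 _  _  = 2
  phase l4 _  _  = 1

  phase-0 : ∀ x → phase l1 (f₁ x) (f₂ x) ≡ 0
  phase-0 l1 = refl
  phase-0 l2 = refl
  phase-0 l3 = refl
  phase-0 l4 = refl

  phase-1 : ∀ x → phase (f₁ x) (f₂ x) l1 ≡ 1
  phase-1 l1 = refl
  phase-1 l2 = refl
  phase-1 l3 = refl
  phase-1 l4 = refl

  phase-2 : ∀ x y → phase (f₂ x) l1 (f₁ y) ≡ 2
  phase-2 l1 y = refl
  phase-2 l2 y = refl
  phase-2 l3 y = refl
  phase-2 l4 l1 = refl
  phase-2 l4 l2 = refl
  phase-2 l4 l3 = refl
  phase-2 l4 l4 = refl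

  phase-correct : ∀ {i} (m : Mod3 i) → phase (w i) (w (1 + i)) (w (2 + i)) ≡ residue m
  phase-correct (3b b refl) rewrite w-3b b | w-3b+1 b | w-3b+2 b = phase-0 (w b)
  phase-correct (3b+1 b refl) rewrite w-3b+1 b | w-3b+2 b | w-3b (suc b) = phase-1 (w b)
  phase-correct (3b+2 b refl) rewrite w-3b+2 b | w-3b (suc b) | w-3b+1 (suc b) = phase-2 (w b) (w (suc b))

  run⇒3∣period : ∀ i q → PeriodicRun i q 3 → 3 ∣ q
  run⇒3∣period i q run = same-residue (mod3 i) (mod3 (i + q)) (begin
    residue (mod3 i)                                        ≡⟨ sym (phase-correct (mod3 i)) ⟩
    phase (w i) (w (1 + i)) (w (2 + i))                     ≡⟨ cong₂ (λ x y → phase x y (w (2 + i))) (agree 0 (s≤s z≤n)) (agree 1 (s≤s (s≤s z≤n))) ⟩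
    phase (w (i + q)) (w (1 + (i + q))) (w (2 + i))         ≡⟨ cong (phase (w (i + q)) (w (1 + (i + q)))) (agree 2 (s≤s (s≤s (s≤s z≤n)))) ⟩
    phase (w (i + q)) (w (1 + (i + q))) (w (2 + (i + q)))   ≡⟨ phase-correct (mod3 (i + q)) ⟩
    residue (mod3 (i + q))                                  ∎)
    where
      open ≡-Reasoning
      agree : ∀ k → k < 3 → w (k + i) ≡ w (k + (i + q))
      agree = run-at {i} {q} run
      shifted : ∀ r b b' → i ≡ r + b * 3 → i + q ≡ r + b' * 3 → 3 ∣ q
      shifted r b b' refl e = ∣m+n∣m⇒∣n (subst (3 ∣_) (sym b*3+q≡b'*3) (n∣m*n b')) (n∣m*n b)
        where b*3+q≡b'*3 : b * 3 + q ≡ b' * 3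
              b*3+q≡b'*3 = +-cancelˡ-≡ r _ _ (trans (sym (+-assoc r (b * 3) q)) e)
      same-residue : (m : Mod3 i) (m' : Mod3 (i + q)) → residue m ≡ residue m' → 3 ∣ q
      same-residue (3b b e) (3b b' e') _ = shifted 0 b b' e e'
      same-residue (3b+1 b e) (3b+1 b' e') _ = shifted 1 b b' e e'
      same-residue (3b+2 b e) (3b+2 b' e') _ = shifted 2 b b' e e'
      same-residue (3b _ _) (3b+1 _ _) ()
      same-residue (3b _ _) (3b+2 _ _) ()
      same-residue (3b+1 _ _) (3b _ _) ()
      same-residue (3b+1 _ _) (3b+2 _ _) ()
      same-residue (3b+2 _ _) (3b _ _) ()
      same-residue (3b+2 _ _) (3b+1 _ _) ()


-- The letter-pair weights, the energy of a run, and kernel runs.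
module Energy where

  open FixedPoint
  open Runs
  open import Data.Nat
  open import Data.Nat.Properties
  open import Data.Product using (_×_; _,_; proj₁; proj₂)
  open import Data.Sum using (inj₁; inj₂)
  open import Relation.Nullary using (Dec; ¬?)
  open import Relation.Nullary.Decidable using (toWitness; _→-dec_; _×-dec_; map′)
  open import Relation.Unary using (Decidable)
  open import Relation.Binary.PropositionalEquality
  open import Data.Nat.Tactic.RingSolver using (solve-∀)

  all-letters? : ∀ {P : A4 → Set} → Decidable P → Dec (∀ a → P a)
  all-letters? {P} P? = map′ combine (λ h → h l1 , h l2 , h l3 , h l4) (P? l1 ×-dec P? l2 ×-dec P? l3 ×-dec P? l4)
    where
      combine : P l1 × P l2 × P l3 × P l4 → ∀ a → P a
      combine (p , _ , _ , _) l1 = p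
      combine (_ , p , _ , _) l2 = p
      combine (_ , _ , p , _) l3 = p
      combine (_ , _ , _ , p) l4 = p

  leftWeight : A4 → A4 → ℕ
  leftWeight l1 l1 = 0
  leftWeight l1 l2 = 27
  leftWeight l1 l3 = 81
  leftWeight l1 l4 = 9
  leftWeight l2 l1 = 27
  leftWeight l2 l2 = 0
  leftWeight l2 l3 = 27
  leftWeight l2 l4 = 9
  leftWeight l3 l1 = 81
  leftWeight l3 l2 = 27
  leftWeight l3 l3 = 0
  leftWeight l3 l4 = 9
  leftWeight l4 l1 = 9
  leftWeight l4 l2 = 9
  leftWeight l4 l3 = 9
  leftWeight l4 l4 = 0

  rightWeight : A4 → A4 → ℕ
  rightWeight l1 l1 = 234
  rightWeight l1 l2 = 195
  rightWeight l1 l3 = 117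
  rightWeight l1 l4 = 117
  rightWeight l2 l1 = 195
  rightWeight l2 l2 = 234
  rightWeight l2 l3 = 117
  rightWeight l2 l4 = 117
  rightWeight l3 l1 = 117
  rightWeight l3 l2 = 117
  rightWeight l3 l3 = 234
  rightWeight l3 l4 = 221
  rightWeight l4 l1 = 117
  rightWeight l4 l2 = 117
  rightWeight l4 l3 = 221
  rightWeight l4 l4 = 234

  -- The weights contract by a factor 3 under desubstitution, with 234 to spare per
  -- position of the run lost in the process; each inequality is checked on all 16 pairs.
  -- Left mismatch at the last letter of a block (the run starts at a block boundary):
  leftWeight-f₂ : ∀ x y → leftWeight (f₂ x) (f₂ y) ≤ 3 * leftWeight x y
  leftWeight-f₂ = toWitness {a? = all-letters? λ x → all-letters? λ y →
    leftWeight (f₂ x) (f₂ y) ≤? 3 * leftWeight x y} _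

  -- Left mismatch at the middle letter of a block (the run starts at its last letter):
  leftWeight-f₁ : ∀ x y → f₁ x ≢ f₁ y → f₂ x ≡ f₂ y → 234 + leftWeight (f₁ x) (f₁ y) ≤ 3 * leftWeight x y
  leftWeight-f₁ = toWitness {a? = all-letters? λ x → all-letters? λ y →
    ¬? (f₁ x ≟A f₁ y) →-dec (f₂ x ≟A f₂ y) →-dec (234 + leftWeight (f₁ x) (f₁ y) ≤? 3 * leftWeight x y)} _

  -- Right mismatch at position 0, 1 or 2 of a block:
  rightWeight-1 : ∀ x y → rightWeight l1 l1 ≤ 3 * rightWeight x y
  rightWeight-1 = toWitness {a? = all-letters? λ x → all-letters? λ y →
    rightWeight l1 l1 ≤? 3 * rightWeight x y} _

  rightWeight-f₁ : ∀ x y → 234 + rightWeight (f₁ x) (f₁ y) ≤ 3 * rightWeight x y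
  rightWeight-f₁ = toWitness {a? = all-letters? λ x → all-letters? λ y →
    234 + rightWeight (f₁ x) (f₁ y) ≤? 3 * rightWeight x y} _

  rightWeight-f₂ : ∀ x y → f₁ x ≡ f₁ y → 468 + rightWeight (f₂ x) (f₂ y) ≤ 3 * rightWeight x y
  rightWeight-f₂ = toWitness {a? = all-letters? λ x → all-letters? λ y →
    (f₁ x ≟A f₁ y) →-dec (468 + rightWeight (f₂ x) (f₂ y) ≤? 3 * rightWeight x y)} _

  leftWeight≤81 : ∀ x y → leftWeight x y ≤ 81
  leftWeight≤81 = toWitness {a? = all-letters? λ x → all-letters? λ y → leftWeight x y ≤? 81} _

  rightWeight-bounds : ∀ x y → 78 ≤ rightWeight x y × rightWeight x y ≤ 234
  rightWeight-bounds = toWitness {a? = all-letters? λ x → all-letters? λ y →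
    78 ≤? rightWeight x y ×-dec rightWeight x y ≤? 234} _

  leftTerm : ℕ → ℕ → ℕ
  leftTerm zero q = 0
  leftTerm (suc i) q = leftWeight (w i) (w (i + q))

  energy : ℕ → ℕ → ℕ → ℕ
  energy i q L = 234 * L + leftTerm i q + rightWeight (w (i + L)) (w (i + L + q))

  energy-suc : ∀ i q L → energy i q L ≤ energy i q (suc L)
  energy-suc i q L = begin
    234 * L + leftTerm i q + rightWeight (w (i + L)) (w (i + L + q))
      ≤⟨ +-monoʳ-≤ (234 * L + leftTerm i q) (proj₂ (rightWeight-bounds _ _)) ⟩
    234 * L + leftTerm i q + 234                 ≡⟨ reorder L (leftTerm i q) ⟩
    234 * suc L + leftTerm i q + 0               ≤⟨ +-monoʳ-≤ (234 * suc L + leftTerm i q) z≤n ⟩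
    energy i q (suc L)                           ∎
    where
      open ≤-Reasoning
      reorder : ∀ L a → 234 * L + a + 234 ≡ 234 * suc L + a + 0
      reorder = solve-∀

  -- Since rightWeight ≤ 234, the energy grows with the length of the run.
  energy-mono : ∀ i q {L L'} → L ≤ L' → energy i q L ≤ energy i q L'
  energy-mono i q {L} {L'} L≤L' with m≤n⇒m<n∨m≡n L≤L'
  ... | inj₂ refl = ≤-refl
  ... | inj₁ (s≤s L≤L'') = ≤-trans (energy-mono i q L≤L'') (energy-suc i q _)

  energy-lower : ∀ i q L → 234 * L + 78 ≤ energy i q L
  energy-lower i q L = +-mono-≤ (m≤m+n (234 * L) (leftTerm i q)) (proj₁ (rightWeight-bounds _ _))

  energy-upper : ∀ i q L → L ≤ 2 → energy i q L ≤ 783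
  energy-upper i q L L≤2 = +-mono-≤ (+-mono-≤ (*-monoʳ-≤ 234 L≤2) (leftTerm≤81 i)) (proj₂ (rightWeight-bounds _ _))
    where
      leftTerm≤81 : ∀ i → leftTerm i q ≤ 81
      leftTerm≤81 zero = z≤n
      leftTerm≤81 (suc i) = leftWeight≤81 _ _

  record KernelRun (i q L : ℕ) : Set where
    constructor kernelRun
    field
      leftMaximal : LeftMaximal i q
      inKernel    : InKer (window i q)
      periodic    : PeriodicRun i q L


-- A kernel run of period 3q' desubstitutes to a kernel run of period q' with a third of the energy.
module Desubstitution where

  open FixedPoint
  open Parikh
  open Runs
  open Energy
  open import Data.Nat
  open import Data.Nat.Properties
  open import Data.Product using (∃₂; _×_; _,_)
  open import Data.Empty using (⊥-elim)
  open import Data.Unit using (tt)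
  open import Relation.Binary.PropositionalEquality
  open import Data.Nat.Tactic.RingSolver using (solve-∀)

  in-blocks : ∀ {k m} r → r < 3 → k < m → r + k * 3 < m * 3
  in-blocks {k} {m} r r<3 k<m = begin-strict
    r + k * 3    <⟨ +-monoˡ-< (k * 3) r<3 ⟩
    3 + k * 3    ≤⟨ *-monoˡ-≤ 3 k<m ⟩
    m * 3        ∎
    where open ≤-Reasoning

  run-blocks : ∀ c q' {L} → PeriodicRun (c * 3) (q' * 3) L → ∀ r k → r + k * 3 < L →
    w (r + (c + k) * 3) ≡ w (r + (c + k + q') * 3)
  run-blocks c q' run r k lt = begin
    w (r + (c + k) * 3)              ≡⟨ cong w (p₁ r c k) ⟩
    w (c * 3 + (r + k * 3))          ≡⟨ run (r + k * 3) lt ⟩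
    w (c * 3 + (r + k * 3) + q' * 3) ≡⟨ cong w (p₂ r c k q') ⟩
    w (r + (c + k + q') * 3)         ∎
    where
      open ≡-Reasoning
      p₁ : ∀ r c k → r + (c + k) * 3 ≡ c * 3 + (r + k * 3)
      p₁ = solve-∀
      p₂ : ∀ r c k q' → c * 3 + (r + k * 3) + q' * 3 ≡ r + (c + k + q') * 3
      p₂ = solve-∀

  -- A run of period 3q' covering m whole blocks desubstitutes to a run of period q' and length m,
  -- because a letter is determined by the last two letters of its image.
  run-desubst : ∀ c q' m {t} → PeriodicRun (c * 3) (q' * 3) (t + m * 3) → PeriodicRun c q' m
  run-desubst c q' m {t} run k k<m = f₁f₂-injective _ _
    (trans (sym (w-3b+1 (c + k))) (trans (agree 1 (s≤s (s≤s z≤n))) (w-3b+1 (c + k + q'))))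
    (trans (sym (w-3b+2 (c + k))) (trans (agree 2 (s≤s (s≤s (s≤s z≤n)))) (w-3b+2 (c + k + q'))))
    where
      inside : ∀ r → r < 3 → r + k * 3 < t + m * 3
      inside r r<3 = <-≤-trans (in-blocks r r<3 k<m) (m≤n+m (m * 3) t)
      agree : ∀ r → r < 3 → w (r + (c + k) * 3) ≡ w (r + (c + k + q') * 3)
      agree r r<3 = run-blocks c q' run r k (inside r r<3)

  block-shift : ∀ r b q' → r + b * 3 + q' * 3 ≡ r + (b + q') * 3
  block-shift = solve-∀

  -- At the right end, a mismatch at position t of a block contracts by 3 under desubstitution,
  -- with 234 to spare per position t; for t = 2 the run forces equal letters at position 1.
  rightWeight-desubst : ∀ c d t → t < 3 → (t ≡ 2 → f₁ (w c) ≡ f₁ (w d)) →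
    234 * t + rightWeight (w (t + c * 3)) (w (t + d * 3)) ≤ 3 * rightWeight (w c) (w d)
  rightWeight-desubst c d 0 _ _ rewrite w-3b c | w-3b d = rightWeight-1 (w c) (w d)
  rightWeight-desubst c d 1 _ _ rewrite w-3b+1 c | w-3b+1 d = rightWeight-f₁ (w c) (w d)
  rightWeight-desubst c d 2 _ f₁≡ rewrite w-3b+2 c | w-3b+2 d = rightWeight-f₂ (w c) (w d) (f₁≡ refl)
  rightWeight-desubst c d (suc (suc (suc _))) (s≤s (s≤s (s≤s ()))) _

  block-desubst : ∀ c q' t m → t < 3 → InKer (window (c * 3) (q' * 3)) → PeriodicRun (c * 3) (q' * 3) (t + m * 3) →
    InKer (window c q') × PeriodicRun c q' m ×
    (234 * t + rightWeight (w (c * 3 + (t + m * 3))) (w (c * 3 + (t + m * 3) + q' * 3))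
       ≤ 3 * rightWeight (w (c + m)) (w (c + m + q')))
  block-desubst c q' t m t<3 ker run = kernel , run-desubst c q' m run , rightEnd
    where
      kernel : InKer (window c q')
      kernel = InKer-f⁻ (window c q') (subst InKer (sym (f-window c q')) ker)
      f₁-agree : t ≡ 2 → f₁ (w (c + m)) ≡ f₁ (w (c + m + q'))
      f₁-agree refl = trans (sym (w-3b+1 (c + m))) (trans (run-blocks c q' run 1 m ≤-refl) (w-3b+1 (c + m + q')))
      p₁ : ∀ c t m → t + (c + m) * 3 ≡ c * 3 + (t + m * 3)
      p₁ = solve-∀
      p₂ : ∀ c t m q' → t + (c + m + q') * 3 ≡ c * 3 + (t + m * 3) + q' * 3
      p₂ = solve-∀
      rightEnd : 234 * t + rightWeight (w (c * 3 + (t + m * 3))) (w (c * 3 + (t + m * 3) + q' * 3))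
                   ≤ 3 * rightWeight (w (c + m)) (w (c + m + q'))
      rightEnd = subst₂ (λ x y → 234 * t + rightWeight (w x) (w y) ≤ 3 * rightWeight (w (c + m)) (w (c + m + q')))
        (p₁ c t m) (p₂ c t m q') (rightWeight-desubst (c + m) (c + m + q') t t<3 f₁-agree)

  -- Left end of a run starting at the block boundary 3b: its left mismatch sits at the last
  -- position of block b − 1, where f₂ is injective and the left weight contracts by 3.
  leftMaximal-3b : ∀ b q' → LeftMaximal (b * 3) (q' * 3) → LeftMaximal b q'
  leftMaximal-3b zero q' _ = tt
  leftMaximal-3b (suc b) q' lm eq =
    lm (trans (w-3b+2 b) (trans (cong f₂ eq) (sym (trans (cong w (block-shift 2 b q')) (w-3b+2 (b + q'))))))

  leftTerm-3b : ∀ b q' → leftTerm (b * 3) (q' * 3) ≤ 3 * leftTerm b q'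
  leftTerm-3b zero q' = z≤n
  leftTerm-3b (suc b) q' = subst (_≤ 3 * leftTerm (suc b) q')
    (sym (cong₂ leftWeight (w-3b+2 b) (trans (cong w (block-shift 2 b q')) (w-3b+2 (b + q')))))
    (leftWeight-f₂ (w b) (w (b + q')))

  -- Left end of a run starting at position 2 of block b: left-maximality says the letters at
  -- position 1 differ, and the run says those at position 2 agree; then w_b ≠ w_{b+q'}.
  module StartInBlock (b q' : ℕ) (lm : LeftMaximal (2 + b * 3) (q' * 3)) (first : w (2 + b * 3) ≡ w (2 + b * 3 + q' * 3)) where

    f₁-differ : f₁ (w b) ≢ f₁ (w (b + q'))
    f₁-differ eq = lm (trans (w-3b+1 b) (trans eq (sym (trans (cong w (block-shift 1 b q')) (w-3b+1 (b + q'))))))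

    f₂-agree : f₂ (w b) ≡ f₂ (w (b + q'))
    f₂-agree = trans (sym (w-3b+2 b)) (trans first (trans (cong w (block-shift 2 b q')) (w-3b+2 (b + q'))))

    leftMaximal : LeftMaximal (suc b) q'
    leftMaximal eq = f₁-differ (cong f₁ eq)

    leftTerm-bound : 234 + leftTerm (2 + b * 3) (q' * 3) ≤ 3 * leftTerm (suc b) q'
    leftTerm-bound = subst (λ x → 234 + x ≤ 3 * leftTerm (suc b) q')
      (sym (cong₂ leftWeight (w-3b+1 b) (trans (cong w (block-shift 1 b q')) (w-3b+1 (b + q')))))
      (leftWeight-f₁ (w b) (w (b + q')) f₁-differ f₂-agree)

  -- Energy bookkeeping: s positions lost on the left and t on the right, each worth 234.
  combine : ∀ s t m a a' r r' → 234 * s + a ≤ 3 * a' → 234 * t + r ≤ 3 * r' →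
    234 * (s + (t + m * 3)) + a + r ≤ 3 * (234 * m + a' + r')
  combine s t m a a' r r' left right = begin
    234 * (s + (t + m * 3)) + a + r                 ≡⟨ regroup s t m a r ⟩
    3 * (234 * m) + (234 * s + a) + (234 * t + r)   ≤⟨ +-mono-≤ (+-monoʳ-≤ (3 * (234 * m)) left) right ⟩
    3 * (234 * m) + 3 * a' + 3 * r'                 ≡⟨ factor m a' r' ⟩
    3 * (234 * m + a' + r')                         ∎
    where
      open ≤-Reasoning
      regroup : ∀ s t m a r → 234 * (s + (t + m * 3)) + a + r ≡ 3 * (234 * m) + (234 * s + a) + (234 * t + r)
      regroup = solve-∀
      factor : ∀ m a' r' → 3 * (234 * m) + 3 * a' + 3 * r' ≡ 3 * (234 * m + a' + r')
      factor = solve-∀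

  Desubstituted : ℕ → ℕ → ℕ → ℕ → Set
  Desubstituted i q' L E = ∃₂ λ j M → KernelRun j q' M × E ≤ 3 * energy j q' M

  desubstitute-3b : ∀ b q' L → KernelRun (b * 3) (q' * 3) L → Desubstituted (b * 3) q' L (energy (b * 3) (q' * 3) L)
  desubstitute-3b b q' L (kernelRun lm ker run) with divide3 L
  ... | t , m , t<3 , refl with block-desubst b q' t m t<3 ker run
  ...   | ker' , run' , rightEnd = b , m , kernelRun (leftMaximal-3b b q' lm) ker' run' ,
          combine 0 t m _ _ _ _ (leftTerm-3b b q') rightEnd

  shift-into-block : ∀ b q' L → KernelRun (2 + b * 3) (q' * 3) (suc L) →
    InKer (window (suc b * 3) (q' * 3)) × PeriodicRun (suc b * 3) (q' * 3) L
  shift-into-block b q' L (kernelRun _ ker run) =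
    InKer-slide (2 + b * 3) (q' * 3) (run-first {2 + b * 3} {q' * 3} run) ker ,
    subst (λ j → PeriodicRun j (q' * 3) L) (+-comm (2 + b * 3) 1) (run-drop {2 + b * 3} {q' * 3} 1 L run)

  desubstitute-3b+2 : ∀ b q' L → KernelRun (2 + b * 3) (q' * 3) (suc L) →
    Desubstituted (2 + b * 3) q' (suc L) (energy (2 + b * 3) (q' * 3) (suc L))
  desubstitute-3b+2 b q' L kr@(kernelRun lm _ run) with shift-into-block b q' L kr | divide3 L
  ... | ker₁ , run₁ | t , m , t<3 , refl with block-desubst (suc b) q' t m t<3 ker₁ run₁
  ...   | ker' , run' , rightEnd = suc b , m , kernelRun S.leftMaximal ker' run' ,
          subst (λ x → 234 * suc (t + m * 3) + leftTerm (2 + b * 3) (q' * 3) + x ≤ _) (sym rightEq)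
            (combine 1 t m _ _ _ _ S.leftTerm-bound rightEnd)
    where
      module S = StartInBlock b q' lm (run-first {2 + b * 3} {q' * 3} run)
      p₁ : ∀ b t m → 2 + b * 3 + suc (t + m * 3) ≡ suc b * 3 + (t + m * 3)
      p₁ = solve-∀
      rightEq : rightWeight (w (2 + b * 3 + suc (t + m * 3))) (w (2 + b * 3 + suc (t + m * 3) + q' * 3))
              ≡ rightWeight (w (suc b * 3 + (t + m * 3))) (w (suc b * 3 + (t + m * 3) + q' * 3))
      rightEq = cong₂ rightWeight (cong w (p₁ b t m)) (cong (λ j → w (j + q' * 3)) (p₁ b t m))

  -- Desubstitution: a nonempty kernel run of period 3q' yields a kernel run of period q'
  -- with at least a third of its energy. (A run cannot start at position 1 of a block:
  -- the letters before it are both 1.)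
  desubstitute : ∀ i q' L → 0 < L → KernelRun i (q' * 3) L → Desubstituted i q' L (energy i (q' * 3) L)
  desubstitute i q' L 0<L kr with mod3 i
  desubstitute i q' L 0<L kr | 3b b refl = desubstitute-3b b q' L kr
  desubstitute i q' L 0<L (kernelRun lm _ _) | 3b+1 b refl =
    ⊥-elim (lm (trans (w-3b b) (sym (trans (cong w (block-shift 0 b q')) (w-3b (b + q'))))))
  desubstitute i q' (suc L) 0<L kr | 3b+2 b refl = desubstitute-3b+2 b q' L kr


-- A finite list containing all factors of w of length 117, obtained by iterating f.
module Factors where

  open FixedPoint
  open Runs
  open import Data.Nat
  open import Data.Nat.Properties
  open import Data.List using (List; []; _∷_; take; drop; map; concatMap; deduplicate; upTo)
  open import Data.List.Properties using (≡-dec)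
  open import Data.List.Membership.Propositional using (_∈_)
  open import Data.List.Membership.Propositional.Properties using (∈-deduplicate⁺; ∈-concat⁺′; ∈-map⁺; ∈-upTo⁺)
  open import Data.List.Relation.Unary.Any using (here; there)
  open import Data.Product using (_,_)
  open import Relation.Binary.PropositionalEquality

  -- The eight factors of length 2 of w (read off the images 121, 123, 141, 142 and their junctions).
  factors2 : List (List A4)
  factors2 = (l1 ∷ l1 ∷ []) ∷ (l1 ∷ l2 ∷ []) ∷ (l1 ∷ l4 ∷ []) ∷ (l2 ∷ l1 ∷ [])
           ∷ (l2 ∷ l3 ∷ []) ∷ (l3 ∷ l1 ∷ []) ∷ (l4 ∷ l1 ∷ []) ∷ (l4 ∷ l2 ∷ []) ∷ []

  factors2-complete : ∀ i → window i 2 ∈ factors2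
  factors2-complete i with mod3 i
  ... | 3b b refl rewrite w-3b b | w-3b+1 b = first (w b)
    where
      first : ∀ x → l1 ∷ f₁ x ∷ [] ∈ factors2
      first l1 = there (here refl)
      first l2 = there (here refl)
      first l3 = there (there (here refl))
      first l4 = there (there (here refl))
  ... | 3b+1 b refl rewrite w-3b+1 b | w-3b+2 b = middle (w b)
    where
      middle : ∀ x → f₁ x ∷ f₂ x ∷ [] ∈ factors2
      middle l1 = there (there (there (here refl)))
      middle l2 = there (there (there (there (here refl))))
      middle l3 = there (there (there (there (there (there (here refl))))))
      middle l4 = there (there (there (there (there (there (there (here refl)))))))
  ... | 3b+2 b refl rewrite w-3b+2 b | w-3b (suc b) = junction (w b)
    where
      junction : ∀ x → f₂ x ∷ l1 ∷ [] ∈ factors2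
      junction l1 = here refl
      junction l2 = there (there (there (there (there (here refl)))))
      junction l3 = here refl
      junction l4 = there (there (there (here refl)))

  extend : ℕ → List (List A4) → List (List A4)
  extend n U = deduplicate (≡-dec _≟A_) (concatMap (λ u → map (λ r → take n (drop r (f u))) (upTo 3)) U)

  image-window : ∀ r n b m → r + n ≤ m * 3 → take n (drop r (f (window b m))) ≡ window (r + b * 3) n
  image-window r n b m r+n≤3m = begin
    take n (drop r (f (window b m)))          ≡⟨ cong (λ u → take n (drop r u)) (f-window b m) ⟩
    take n (drop r (window (b * 3) (m * 3)))  ≡⟨ cong (take n) (drop-window (b * 3) r (m * 3)) ⟩
    take n (window (b * 3 + r) (m * 3 ∸ r))   ≡⟨ take-window (b * 3 + r) (m+n≤o⇒m≤o∸n n (subst (_≤ m * 3) (+-comm r n) r+n≤3m)) ⟩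
    window (b * 3 + r) n                      ≡⟨ cong (λ j → window j n) (+-comm (b * 3) r) ⟩
    window (r + b * 3) n                      ∎
    where open ≡-Reasoning

  extend-complete : ∀ n m U → n + 2 ≤ m * 3 → (∀ i → window i m ∈ U) → ∀ i → window i n ∈ extend n U
  extend-complete n m U n+2≤3m complete i with divide3 i
  ... | r , b , r<3 , refl = ∈-deduplicate⁺ (≡-dec _≟A_) (∈-concat⁺′ offset (∈-map⁺ _ (complete b)))
    where
      r+n≤3m : r + n ≤ m * 3
      r+n≤3m = ≤-trans (+-monoˡ-≤ n (≤-pred r<3)) (subst (_≤ m * 3) (+-comm n 2) n+2≤3m)
      offset : window (r + b * 3) n ∈ map (λ r → take n (drop r (f (window b m)))) (upTo 3)
      offset = subst (_∈ _) (image-window r n b m r+n≤3m) (∈-map⁺ (λ r → take n (drop r (f (window b m)))) (∈-upTo⁺ r<3))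

  factors117 : List (List A4)
  factors117 = extend 117 (extend 40 (extend 14 (extend 6 (extend 3 factors2))))

  factors117-complete : ∀ i → window i 117 ∈ factors117
  factors117-complete =
    extend-complete 117 40 _ (≤ᵇ⇒≤ 119 120 _) (
    extend-complete 40 14 _ ≤-refl (
    extend-complete 14 6 _ (≤ᵇ⇒≤ 16 18 _) (
    extend-complete 6 3 _ (≤ᵇ⇒≤ 8 9 _) (
    extend-complete 3 2 _ (≤ᵇ⇒≤ 5 6 _) factors2-complete))))


-- The energy bound for runs shorter than 3, by a finite check on the factors of length 117.
module BaseCase where

  open FixedPoint
  open Parikh
  open Runs
  open Energy
  open Factors
  open import Data.Nat
  open import Data.Nat.Properties
  open import Data.Nat.Divisibility using (_∣_; _∣?_; divides)
  open import Data.Bool using (Bool; true; T; not; _∨_)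
  open import Data.List using (List; _∷_; take; drop; applyUpTo; length)
  open import Data.List.Relation.Unary.All using (All; all?; lookup)
  open import Data.List.Membership.Propositional using (_∈_)
  open import Data.List.Membership.Propositional.Properties using (∈-applyUpTo⁺)
  open import Relation.Nullary using (Dec; yes; no; does)
  open import Relation.Nullary.Decidable using (toWitness; T?; dec-true; dec-false)
  open import Relation.Binary.PropositionalEquality
  open import Data.Empty using (⊥-elim)
  open import Data.Sum using (inj₁; inj₂)

  InKer? : ∀ v → Dec (InKer v)
  InKer? v = all-letters? (λ a → 4 ∣? count a v)

  boundAtMismatch : (q a : ℕ) (x : List A4) (L k : ℕ) → Bool
  boundAtMismatch q a x L zero = true
  boundAtMismatch q a x L (suc k) with atD x L ≟A atD x (L + q)
  ... | yes _ = boundAtMismatch q a x (suc L) k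
  ... | no _ = 34 * (234 * L + a + rightWeight (atD x L) (atD x (L + q))) ≤ᵇ 234 * q

  windowOK : ℕ → List A4 → ℕ → Bool
  windowOK a x q = not (does (InKer? (take q x))) ∨ boundAtMismatch q a x 0 3

  -- The same for a window u one letter earlier, which carries the left term.
  innerWindowOK : List A4 → ℕ → Bool
  innerWindowOK u q = does (atD u 0 ≟A atD u q) ∨ windowOK (leftWeight (atD u 0) (atD u q)) (drop 1 u) q

  smallPeriods : List ℕ
  smallPeriods = applyUpTo (λ j → suc j * 4) 28

  innerWindowsOK : All (λ u → All (λ q → T (innerWindowOK u q)) smallPeriods) factors117
  innerWindowsOK = toWitness {a? = all? (λ u → all? (λ q → T? (innerWindowOK u q)) smallPeriods) factors117} _

  prefixOK : All (λ q → T (windowOK 0 (take 116 (fIter 5)) q)) smallPeriods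
  prefixOK = toWitness {a? = all? (λ q → T? (windowOK 0 (take 116 (fIter 5)) q)) smallPeriods} _

  boundAtMismatch-sound : ∀ q a x L k → T (boundAtMismatch q a x L k) →
    ∀ M → L ≤ M → M < k + L → (∀ j → L ≤ j → j < M → atD x j ≡ atD x (j + q)) → atD x M ≢ atD x (M + q) →
    34 * (234 * M + a + rightWeight (atD x M) (atD x (M + q))) ≤ 234 * q
  boundAtMismatch-sound q a x L zero _ M L≤M M<L _ _ = ⊥-elim (<⇒≱ M<L L≤M)
  boundAtMismatch-sound q a x L (suc k) ok M L≤M M<k+L agree differ with atD x L ≟A atD x (L + q) | m≤n⇒m<n∨m≡n L≤M
  ... | yes same | inj₂ refl = ⊥-elim (differ same)
  ... | yes _ | inj₁ L<M =
    boundAtMismatch-sound q a x (suc L) k ok M L<M (subst (M <_) (sym (+-suc k L)) M<k+L)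
      (λ j 1+L≤j j<M → agree j (≤-trans (n≤1+n L) 1+L≤j) j<M) differ
  ... | no _ | inj₂ refl = ≤ᵇ⇒≤ _ _ ok
  ... | no differ-L | inj₁ L<M = ⊥-elim (differ-L (agree L ≤-refl L<M))

  windowOK-sound : ∀ i q L → q ≤ 112 → L ≤ 2 → T (windowOK (leftTerm i q) (window i 116) q) →
    InKer (window i q) → PeriodicRun i q L → w (i + L) ≢ w (i + L + q) → 34 * energy i q L ≤ 234 * q
  windowOK-sound i q L q≤112 L≤2 ok ker run mismatch = begin
    34 * energy i q L                                                          ≡⟨ cong (34 *_) energy-in-window ⟩
    34 * (234 * L + leftTerm i q + rightWeight (atD x L) (atD x (L + q)))     ≤⟨ at-mismatch ⟩
    234 * q                                                                    ∎
    where
      open ≤-Reasoning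
      x : List A4
      x = window i 116
      L≤114 : L ≤ 114
      L≤114 = ≤-trans L≤2 (≤ᵇ⇒≤ 2 114 _)
      letter : ∀ j → j ≤ 114 → atD x j ≡ w (i + j)
      letter j j≤114 = atD-window i {116} (s≤s (≤-trans j≤114 (n≤1+n 114)))
      letter+q : ∀ j → j ≤ 2 → atD x (j + q) ≡ w (i + j + q)
      letter+q j j≤2 = trans (letter (j + q) (+-mono-≤ j≤2 q≤112)) (cong w (sym (+-assoc i j q)))
      energy-in-window : energy i q L ≡ 234 * L + leftTerm i q + rightWeight (atD x L) (atD x (L + q))
      energy-in-window = sym (cong₂ (λ y z → 234 * L + leftTerm i q + rightWeight y z)
        (letter L L≤114) (letter+q L L≤2))
      in-kernel : does (InKer? (take q x)) ≡ true
      in-kernel = dec-true (InKer? (take q x)) (subst InKer (sym (take-window i (≤-trans q≤112 (≤ᵇ⇒≤ 112 116 _)))) ker)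
      scan-ok : T (boundAtMismatch q (leftTerm i q) x 0 3)
      scan-ok = subst (λ b → T (not b ∨ boundAtMismatch q (leftTerm i q) x 0 3)) in-kernel ok
      agree : ∀ j → 0 ≤ j → j < L → atD x j ≡ atD x (j + q)
      agree j _ j<L = trans (letter j (≤-trans (<⇒≤ j<L) L≤114)) (trans (run j j<L) (sym (letter+q j (≤-trans (<⇒≤ j<L) L≤2))))
      at-mismatch : 34 * (234 * L + leftTerm i q + rightWeight (atD x L) (atD x (L + q))) ≤ 234 * q
      at-mismatch = boundAtMismatch-sound q (leftTerm i q) x 0 3 scan-ok L z≤n (s≤s (≤-trans L≤2 (≤-reflexive (sym (+-identityʳ 2)))))
        agree (λ eq → mismatch (trans (sym (letter L L≤114)) (trans eq (letter+q L L≤2))))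

  drop-atD : ∀ P {k} → k < length P → drop k P ≡ atD P k ∷ drop (suc k) P
  drop-atD (a ∷ P) {zero} _ = refl
  drop-atD (a ∷ P) {suc k} (s≤s k<) = drop-atD P k<

  window-fIter : ∀ k i n → i + n ≤ 3 ^ k → window i n ≡ take n (drop i (fIter k))
  window-fIter k i zero _ = refl
  window-fIter k i (suc n) i+n<3^k = begin
    w i ∷ window (suc i) n                          ≡⟨ cong₂ _∷_ (w-fIter k i i<3^k) (window-fIter k (suc i) n (subst (_≤ 3 ^ k) (+-suc i n) i+n<3^k)) ⟩
    atD (fIter k) i ∷ take n (drop (suc i) (fIter k)) ≡⟨ cong (take (suc n)) (sym (drop-atD (fIter k) (subst (i <_) (sym (length-fIter k)) i<3^k))) ⟩
    take (suc n) (drop i (fIter k))                 ∎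
    where
      open ≡-Reasoning
      i<3^k : i < 3 ^ k
      i<3^k = <-≤-trans (m<m+n i (s≤s z≤n)) i+n<3^k

  -- Every left-maximal window with a small period passes its check: the window at 0 lies in
  -- the prefix f^5(1), and any other one is preceded by a mismatching letter inside a factor of length 117.
  window-checked : ∀ i q → q ∈ smallPeriods → q ≤ 112 → LeftMaximal i q → T (windowOK (leftTerm i q) (window i 116) q)
  window-checked zero q q-small _ _ =
    subst (λ x → T (windowOK 0 x q)) (sym (window-fIter 5 0 116 (≤ᵇ⇒≤ 116 243 _))) (lookup prefixOK q-small)
  window-checked (suc i) q q-small q≤112 lm =
    subst (λ b → T (b ∨ windowOK (leftTerm (suc i) q) (window (suc i) 116) q)) (dec-false (w i ≟A w (i + q)) lm)
      (subst (λ y → T (does (w i ≟A y) ∨ windowOK (leftWeight (w i) y) (window (suc i) 116) q))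
        (atD-window i {117} (s≤s (≤-trans q≤112 (≤ᵇ⇒≤ 112 116 _))))
        (lookup (lookup innerWindowsOK (factors117-complete i)) q-small))

  -- Large periods need no computation: runs of length ≤ 2 have energy at most 783.
  base-large : ∀ i q L → 116 ≤ q → L ≤ 2 → 34 * energy i q L ≤ 234 * q
  base-large i q L 116≤q L≤2 = begin
    34 * energy i q L    ≤⟨ *-monoʳ-≤ 34 (energy-upper i q L L≤2) ⟩
    34 * 783             ≤⟨ ≤ᵇ⇒≤ (34 * 783) (234 * 116) _ ⟩
    234 * 116            ≤⟨ *-monoʳ-≤ 234 116≤q ⟩
    234 * q              ∎
    where open ≤-Reasoning

  -- Its period is a multiple of 4 (Parikh vector in ker ψ); periods up to 112 are covered
  -- by the finite verification and larger ones by base-large.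
  base : ∀ i q L → 0 < q → L ≤ 2 → KernelRun i q L → w (i + L) ≢ w (i + L + q) → 34 * energy i q L ≤ 234 * q
  base i q L 0<q L≤2 (kernelRun lm ker run) mismatch
    with subst (4 ∣_) (length-window i q) (InKer⇒4∣length (window i q) ker)
  ... | divides zero refl = ⊥-elim (<-irrefl refl 0<q)
  ... | divides (suc j) refl with j <? 28
  ...   | yes j<28 = windowOK-sound i q L q≤112 L≤2 (window-checked i q q-small q≤112 lm) ker run mismatch
    where
      q≤112 : q ≤ 112
      q≤112 = *-monoˡ-≤ 4 j<28
      q-small : q ∈ smallPeriods
      q-small = ∈-applyUpTo⁺ (λ j → suc j * 4) j<28
  ...   | no j≮28 = base-large i q L (*-monoˡ-≤ 4 (s≤s (≮⇒≥ j≮28))) L≤2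


-- The energy bound for all periods, and the resulting estimate 34 L < q.
module MainEstimate where

  open FixedPoint
  open Runs
  open Energy
  open Desubstitution
  open BaseCase
  open import Data.Nat
  open import Data.Nat.Properties
  open import Data.Nat.Divisibility using (divides)
  open import Data.Nat.Induction using (<-rec)
  open import Data.Product using (∃; ∃₂; _×_; _,_)
  open import Data.Sum using (_⊎_; inj₁; inj₂)
  open import Data.Empty using (⊥-elim)
  open import Data.Unit using (tt)
  open import Relation.Nullary using (yes; no)
  open import Relation.Binary.PropositionalEquality
  open import Data.Nat.Tactic.RingSolver using (solve-∀)

  EnergyBound : ℕ → Set
  EnergyBound q = 0 < q → ∀ i L → KernelRun i q L → 34 * energy i q L ≤ 234 * q

  extend-right : ∀ n {i q L} → PeriodicRun i q L →
    ∃ λ L' → L ≤ L' × PeriodicRun i q L' × (n + L ≤ L' ⊎ w (i + L') ≢ w (i + L' + q))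
  extend-right zero {L = L} run = L , ≤-refl , run , inj₁ ≤-refl
  extend-right (suc n) {i} {q} {L} run with w (i + L) ≟A w (i + L + q)
  ... | no differ = L , ≤-refl , run , inj₂ differ
  ... | yes agree with extend-right n {i} {q} (run-extend {i} {q} run agree)
  ...   | L' , 1+L≤L' , run' , inj₁ n+1+L≤L' = L' , <⇒≤ 1+L≤L' , run' , inj₁ (subst (_≤ L') (+-suc n L) n+1+L≤L')
  ...   | L' , 1+L≤L' , run' , inj₂ differ = L' , <⇒≤ 1+L≤L' , run' , inj₂ differ

  -- Long runs: their period is 3q' and the energy bound for q' transfers by desubstitution.
  descent : ∀ q → (∀ {q'} → q' < q → EnergyBound q') → 0 < q → ∀ i L → 3 ≤ L → KernelRun i q L →
    34 * energy i q L ≤ 234 * q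
  descent q ih 0<q i L 3≤L kr with run⇒3∣period i q (run-restrict {i} {q} 3≤L (KernelRun.periodic kr))
  ... | divides zero refl = ⊥-elim (<-irrefl refl 0<q)
  ... | divides (suc q') refl with desubstitute i (suc q') L (<-≤-trans (s≤s z≤n) 3≤L) kr
  ...   | j , M , kr' , E≤3E' = begin
    34 * energy i (suc q' * 3) L          ≤⟨ *-monoʳ-≤ 34 E≤3E' ⟩
    34 * (3 * energy j (suc q') M)        ≡⟨ swap (energy j (suc q') M) ⟩
    3 * (34 * energy j (suc q') M)        ≤⟨ *-monoʳ-≤ 3 (ih q'<q (s≤s z≤n) j M kr') ⟩
    3 * (234 * suc q')                    ≡⟨ regroup (suc q') ⟩
    234 * (suc q' * 3)                    ∎
    where
      open ≤-Reasoning
      q'<q : suc q' < suc q' * 3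
      q'<q = m<m*n (suc q') 3 (s≤s (s≤s z≤n))
      swap : ∀ E → 34 * (3 * E) ≡ 3 * (34 * E)
      swap = solve-∀
      regroup : ∀ x → 3 * (234 * x) ≡ 234 * (x * 3)
      regroup = solve-∀

  -- The energy bound holds for every period, by strong induction: extend the run to the right
  -- until it has length 3 (then descend) or stops at a mismatch (then use the base case).
  energy-bound : ∀ q → EnergyBound q
  energy-bound = <-rec EnergyBound step
    where
      step : ∀ q → (∀ {q'} → q' < q → EnergyBound q') → EnergyBound q
      step q ih 0<q i L (kernelRun lm ker run) with extend-right 3 {i} {q} run
      ... | L' , L≤L' , run' , stop = ≤-trans (*-monoʳ-≤ 34 (energy-mono i q L≤L')) (at-end stop)
        where
          at-end : 3 + L ≤ L' ⊎ w (i + L') ≢ w (i + L' + q) → 34 * energy i q L' ≤ 234 * q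
          at-end stop with 3 ≤? L'
          ... | yes 3≤L' = descent q ih 0<q i L' 3≤L' (kernelRun lm ker run')
          ... | no 3≰L' with stop
          ...   | inj₁ 3+L≤L' = ⊥-elim (3≰L' (≤-trans (m≤m+n 3 L) 3+L≤L'))
          ...   | inj₂ differ = base i q L' 0<q (≤-pred (≰⇒> 3≰L')) (kernelRun lm ker run') differ

  extend-left : ∀ q i L → InKer (window i q) → PeriodicRun i q L → ∃₂ λ i₀ L₀ → KernelRun i₀ q L₀ × L ≤ L₀
  extend-left q zero L ker run = 0 , L , kernelRun tt ker run , ≤-refl
  extend-left q (suc i) L ker run with w i ≟A w (i + q)
  ... | no differ = suc i , L , kernelRun differ ker run , ≤-refl
  ... | yes agree with extend-left q i (suc L) (InKer-slideˡ i q agree ker) (run-extendˡ {i} {q} run agree)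
  ...   | i₀ , L₀ , kr , 1+L≤L₀ = i₀ , L₀ , kr , <⇒≤ 1+L≤L₀

  run-bound : ∀ q i L → 0 < q → InKer (window i q) → PeriodicRun i q L → 34 * L < q
  run-bound q i L 0<q ker run with extend-left q i L ker run
  ... | i₀ , L₀ , kr , L≤L₀ = ≤-<-trans (*-monoʳ-≤ 34 L≤L₀) (*-cancelˡ-< 234 (34 * L₀) q (begin-strict
    234 * (34 * L₀)               ≡⟨ swap L₀ ⟩
    34 * (234 * L₀ + 0)           <⟨ *-monoʳ-< 34 (+-monoʳ-< (234 * L₀) (s≤s z≤n)) ⟩
    34 * (234 * L₀ + 78)          ≤⟨ *-monoʳ-≤ 34 (energy-lower i₀ q L₀) ⟩
    34 * energy i₀ q L₀           ≤⟨ energy-bound q 0<q i₀ L₀ kr ⟩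
    234 * q                       ∎))
    where
      open ≤-Reasoning
      swap : ∀ L → 234 * (34 * L) ≡ 34 * (234 * L + 0)
      swap = solve-∀


-- From factors with a kernel period to runs, and the final comparison of fractions.
module Conclusion where

  open FixedPoint
  open Runs
  open MainEstimate
  open import Data.Nat as ℕ using (ℕ; zero; suc; NonZero; _*_)
  import Data.Nat.Properties as ℕP
  open import Data.Integer as ℤ using (+_; +<+)
  import Data.Integer.Properties as ℤP
  open import Data.Rational as ℚ using (_/_; _<_; _≤_; NonNegative)
  open import Data.Rational.Properties as ℚP using (toℚᵘ-cancel-<; toℚᵘ-fromℚᵘ)
  import Data.Rational.Unnormalised as ℚᵘ
  import Data.Rational.Unnormalised.Properties as ℚᵘP
  open import Data.List using (List; length; take)
  open import Data.Maybe using (just)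
  open import Data.Maybe.Properties using (just-injective)
  open import Data.Product using (_,_)
  open import Relation.Binary.PropositionalEquality
  open import Data.Nat.Tactic.RingSolver using (solve-∀)

  factor-run : ∀ v i q → v ≡ window i (length v) → HasPeriod v q → PeriodicRun i q (length v ℕ.∸ q)
  factor-run v i q v≡ (_ , q≤n , periodic) k k<n-q = just-injective (begin
    just (w (i ℕ.+ k))               ≡⟨ sym (at-window i k<n) ⟩
    at (window i n) k                ≡⟨ cong (λ u → at u k) (sym v≡) ⟩
    at v k                           ≡⟨ periodic k k+q<n ⟩
    at v (k ℕ.+ q)                   ≡⟨ cong (λ u → at u (k ℕ.+ q)) v≡ ⟩
    at (window i n) (k ℕ.+ q)        ≡⟨ at-window i k+q<n ⟩
    just (w (i ℕ.+ (k ℕ.+ q)))       ≡⟨ cong (λ j → just (w j)) (sym (ℕP.+-assoc i k q)) ⟩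
    just (w (i ℕ.+ k ℕ.+ q))         ∎)
    where
      open ≡-Reasoning
      n : ℕ
      n = length v
      k+q<n : k ℕ.+ q ℕ.< n
      k+q<n = subst (k ℕ.+ q ℕ.<_) (ℕP.m∸n+n≡m q≤n) (ℕP.+-monoˡ-< q k<n-q)
      k<n : k ℕ.< n
      k<n = ℕP.≤-<-trans (ℕP.m≤m+n k q) k+q<n

  /-<-/ : ∀ n q a d .{{_ : NonZero q}} .{{_ : NonZero d}} → n * d ℕ.< a * q → (+ n / q) < (+ a / d)
  /-<-/ n q@(suc q₋₁) a d@(suc d₋₁) nd<aq = toℚᵘ-cancel-<
    (ℚᵘP.<-respˡ-≃ (ℚᵘP.≃-sym (toℚᵘ-fromℚᵘ (ℚᵘ.mkℚᵘ (+ n) q₋₁)))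
    (ℚᵘP.<-respʳ-≃ (ℚᵘP.≃-sym (toℚᵘ-fromℚᵘ (ℚᵘ.mkℚᵘ (+ a) d₋₁)))
    (ℚᵘ.*<* (subst₂ ℤ._<_ (ℤP.pos-* n d) (ℤP.pos-* a q) (+<+ nd<aq)))))

  35/34≤bound : ∀ s → (+ 35 / 34) ≤ bound s
  35/34≤bound s = subst (_≤ bound s) (ℚP.+-identityʳ (+ 35 / 34))
    (ℚP.+-monoʳ-≤ (+ 35 / 34) (ℚP.nonNegative⁻¹ ((+ 3 / 1966) ℚ.* geomSum s) {{ℚP.nonNeg*nonNeg⇒nonNeg (+ 3 / 1966) (geomSum s) {{geomSum≥0 s}}}}))
    where
      inv3pow≥0 : ∀ j → NonNegative (inv3pow j)
      inv3pow≥0 zero = _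
      inv3pow≥0 (suc j) = ℚP.nonNeg*nonNeg⇒nonNeg (inv3pow j) {{inv3pow≥0 j}} (+ 1 / 3)
      geomSum≥0 : ∀ s → NonNegative (geomSum s)
      geomSum≥0 zero = _
      geomSum≥0 (suc s) = ℚP.nonNeg+nonNeg⇒nonNeg (geomSum s) {{geomSum≥0 s}} (inv3pow s) {{inv3pow≥0 s}}

  factor-bound : ∀ v q i → v ≡ factorAt i (length v) → KernelPeriod v q → length v * 34 ℕ.< 35 * q
  factor-bound v q i v≡factor (period@(0<q , q≤n , _) , ker) = begin-strict
    n * 34                          ≡⟨ cong (_* 34) (sym (ℕP.m∸n+n≡m q≤n)) ⟩
    (n ℕ.∸ q ℕ.+ q) * 34            ≡⟨ split (n ℕ.∸ q) q ⟩
    34 * (n ℕ.∸ q) ℕ.+ 34 * q       <⟨ ℕP.+-monoˡ-< (34 * q) short ⟩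
    q ℕ.+ 34 * q                    ≡⟨ collect q ⟩
    35 * q                          ∎
    where
      open ℕP.≤-Reasoning
      n : ℕ
      n = length v
      v≡window : v ≡ window i n
      v≡window = trans v≡factor (factorAt≡window i n)
      ker-window : InKer (window i q)
      ker-window = subst InKer (trans (cong (take q) v≡window) (take-window i q≤n)) ker
      short : 34 * (n ℕ.∸ q) ℕ.< q
      short = run-bound q i (n ℕ.∸ q) 0<q ker-window (factor-run v i q v≡window period)
      split : ∀ d q → (d ℕ.+ q) * 34 ≡ 34 * d ℕ.+ 34 * q
      split = solve-∀
      collect : ∀ q → q ℕ.+ 34 * q ≡ 35 * q
      collect = solve-∀

open Conclusion using (factor-bound; /-<-/; 35/34≤bound)
open import Data.Nat using (ℕ; _*_; _^_; _≤_; NonZero)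
open import Data.List using (List; length)
open import Data.Integer using (+_)
open import Data.Rational using (_/_; _<_)
open import Data.Rational.Properties using (<-≤-trans)
open import Data.Product using (_,_)

-- The theorem, in fact with the sharper s-independent bound |v|/q < 35/34.
mainTheorem1 : (s : ℕ) (v : List A4) (q : ℕ) .{{_ : NonZero q}} →
    IsFactor v → KernelPeriod v q → q ≤ 1966 * 3 ^ s →
    (+ length v / q) < bound s
mainTheorem1 s v q (i , v≡factor) kernelPeriod _ =
  <-≤-trans (/-<-/ (length v) q 35 34 (factor-bound v q i v≡factor kernelPeriod)) (35/34≤bound s)
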